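{- Let $(\mathscr{L},W)$ be a logical structure with $\mathscr{L}\neq\emptyset$ and $W$ monotonic. Then $(\mathscr{L},W)$ is anti-reflexive if and only if $W(\Gamma)=\emptyset$ for every nonempty $\Gamma\subseteq\mathscr{L}$.
   Context: A logical structure is a pair $(\mathscr{L},W)$ with $W:\mathcal{P}(\mathscr{L})\to\mathcal{P}(\mathscr{L})$; $W$ is monotonic if $\Gamma\subseteq\Sigma$ implies $W(\Gamma)\subseteq W(\Sigma)$. A nonempty set $\Gamma\subseteq\mathscr{L}$ satisfies anti-reflexivity if $\Gamma\cap W(\Gamma)=\emptyset$; $(\mathscr{L},W)$ is anti-reflexive if every nonempty $\Gamma\subseteq\mathscr{L}$ satisfies anti-reflexivity. -}

module Defs where

open import Level using (0ℓ; suc)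
open import Data.Product using (Σ; ∃; _×_; _,_)
open import Relation.Unary using (Pred; _⊆_; _∈_; _∉_; Empty; Satisfiable; _∩_)
open import Relation.Nullary using (¬_)

-- A logical structure (L , W): L a type of formulas, W an operator on subsets of L.
-- Subsets of L are predicates  Pred L 0ℓ.
Operator : Set → Set₁
Operator L = Pred L 0ℓ → Pred L 0ℓ

Monotonic : {L : Set} → Operator L → Set₁
Monotonic {L} W = ∀ (Γ Δ : Pred L 0ℓ) → Γ ⊆ Δ → W Γ ⊆ W Δ

SatisfiesAntiReflexivity : {L : Set} → Operator L → Pred L 0ℓ → Set
SatisfiesAntiReflexivity W Γ = Empty (Γ ∩ W Γ)

AntiReflexive : {L : Set} → Operator L → Set₁
AntiReflexive {L} W = ∀ (Γ : Pred L 0ℓ) → Satisfiable Γ → SatisfiesAntiReflexivity W Γ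

-- If W is monotonic and some x lies in W Γ, then x lies in W (Γ ∪ {x}) as well as in Γ ∪ {x},
-- so the nonempty set Γ ∪ {x} violates anti-reflexivity.
module Submission where

open import Defs
open import Level using (0ℓ)
open import Data.Product using (_×_; _,_)
open import Data.Sum using (inj₁; inj₂)
open import Relation.Unary using (Pred; Empty; Satisfiable; _∪_; ｛_｝)
open import Relation.Binary.PropositionalEquality using (refl)

module _ {L : Set} {W : Operator L} where

  antiReflexive⇒empty-image : Monotonic W → AntiReflexive W →
    ∀ (Γ : Pred L 0ℓ) → Empty (W Γ)
  antiReflexive⇒empty-image mono ar Γ x x∈WΓ =
    ar Γ∪x (x , inj₂ refl) x (inj₂ refl , mono Γ Γ∪x inj₁ x∈WΓ)
    where
    Γ∪x : Pred L 0ℓ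
    Γ∪x = Γ ∪ ｛ x ｝

  empty-image⇒antiReflexive : (∀ (Γ : Pred L 0ℓ) → Satisfiable Γ → Empty (W Γ)) →
    AntiReflexive W
  empty-image⇒antiReflexive empty Γ Γ≢∅ x (_ , x∈WΓ) = empty Γ Γ≢∅ x x∈WΓ

mainTheorem14 : (L : Set) (W : Operator L) → L → Monotonic W →
    (AntiReflexive W → ∀ (Γ : Pred L 0ℓ) → Satisfiable Γ → Empty (W Γ))
    × ((∀ (Γ : Pred L 0ℓ) → Satisfiable Γ → Empty (W Γ)) → AntiReflexive W)
mainTheorem14 L W _ mono =
  (λ ar Γ _ → antiReflexive⇒empty-image mono ar Γ) , empty-image⇒antiReflexive
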